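{- For $n\ge1$ let $d_n$ be the number of rows with value $1$ in the truth tables of all bracketed m-implications with $n$ distinct variables, and let $C_n=\frac1n\binom{2n-2}{n-1}$. Then for every $n\ge1$, $d_n\equiv C_n\pmod 2$.
   Context: Truth values are $1$ (true), $0$ (false). The connective $\rightharpoonup$ satisfies $\nu(\phi\rightharpoonup\psi)=0$ iff $\nu(\phi)=\nu(\psi)=1$, and $=1$ otherwise. A bracketed m-implication with $n$ variables is a well-formed formula obtained from $p_1\rightharpoonup\cdots\rightharpoonup p_n$ ($p_i$ distinct variables, in this order) by inserting brackets. $d_n$ is the total, over all such formulae $\phi$, of the number of valuations $\nu$ of $p_1,\dots,p_n$ with $\nu(\phi)=1$. (The paper phrases the conclusion as "the sequence $d_n$ preserves the parity of $C_n$".) -}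

module Defs where

open import Data.Nat using (ℕ; zero; suc; _+_; _*_; _∸_; _/_)
open import Data.Nat.Combinatorics using (_C_)
open import Data.Nat.ListAction using (sum)
open import Data.Bool using (Bool; true; false)
open import Data.Fin using (Fin)
open import Data.List using (List; []; _∷_; map; concatMap; length; upTo; cartesianProductWith; _++_; filter)
open import Data.Vec using (Vec; lookup)
import Data.Vec as Vec
open import Data.Product using (_×_; _,_)

data Formula (n : ℕ) : Set where
  var : Fin n → Formula n
  _⇀_ : Formula n → Formula n → Formula n

mimp : Bool → Bool → Bool
mimp true true = false
mimp _    _    = true

eval : ∀ {n} → Vec Bool n → Formula n → Bool
eval ν (var i) = lookup ν i
eval ν (φ ⇀ ψ) = mimp (eval ν φ) (eval ν ψ)

splits : ∀ {A : Set} → A → List A → List (List A × List A)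
splits x []       = []
splits x (y ∷ ys) = (x ∷ [] , y ∷ ys) ∷ map (λ { (l , r) → (x ∷ l , r) }) (splits y ys)

-- All bracketings of the word  v₁ ⇀ v₂ ⇀ ⋯ ⇀ vₖ  (variables in this order),
-- for a nonempty list of variables (x ∷ xs).  Fuel k = length bound.
bracketingsF : ∀ {n} → ℕ → Fin n → List (Fin n) → List (Formula n)
bracketingsF fuel x [] = var x ∷ []
bracketingsF zero x (y ∷ ys) = []
bracketingsF (suc fuel) x (y ∷ ys) =
  concatMap (λ { (l , r) → go l r }) (splits x (y ∷ ys))
  where
  sub : List (Fin _) → List (Formula _)
  sub []       = []
  sub (z ∷ zs) = bracketingsF fuel z zs
  go : List (Fin _) → List (Fin _) → List (Formula _)
  go l r = cartesianProductWith _⇀_ (sub l) (sub r)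

bracketings : (n : ℕ) → List (Formula (suc n))
bracketings n = bracketingsF (suc n) (Data.Fin.zero) (Data.List.map Data.Fin.suc (Data.List.allFin n))

valuations : (n : ℕ) → List (Vec Bool n)
valuations zero    = Vec.[] ∷ []
valuations (suc n) = concatMap (λ v → (true Vec.∷ v) ∷ (false Vec.∷ v) ∷ []) (valuations n)

countTrue : ∀ {n} → Formula n → ℕ
countTrue {n} φ = length (filter (λ ν → Data.Bool._≟_ (eval ν φ) true) (valuations n))

-- d (suc m) is d_{m+1}: total number of true rows over all bracketings with m+1 variables.
d : (n : ℕ) → ℕ
d zero    = 0
d (suc m) = sum (map countTrue (bracketings m))

Cat : (n : ℕ) → ℕ
Cat zero    = 0
Cat (suc m) = ((2 * m) C m) / suc m

-- A bracketed m-implication with distinct variables has an odd number of true rows. Working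
-- modulo 2, sum over the value of the leftmost variable p: writing the formula as
-- (((p ⇀ ψ₁) ⇀ ψ₂) ⋯ ⇀ ψₖ), where the ψᵢ do not mention p, the sum equals the number of rows
-- satisfying ψ₁ ∧ ⋯ ∧ ψₖ, a conjunction of formulas in the remaining variables; induct on the
-- number of variables. Hence d_n is congruent to the number of bracketings, a Catalan number.
-- Modulo 2 the Catalan recurrence collapses (pair (a, b) with (b, a)) to c₂ⱼ₊₁ ≡ cⱼ, c₂ⱼ₊₂ ≡ 0,
-- and C(2k, k)/(k + 1) = C(2k, k) − C(2k, k + 1) satisfies the same by Lucas' theorem mod 2.
module Submission where

open import Defs
open import Data.Bool using (Bool; true; false; _∧_; _xor_; _≟_)
open import Data.Bool.ListAction using (all)
open import Data.Bool.Properties using (∧-identityʳ; xor-annihilates-not; xor-same; xor-identityʳ)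
open import Data.Fin using (Fin; zero; suc)
import Data.Fin.Properties as Fin
open import Data.List using (List; []; _∷_; _++_; map; concatMap; length; filter; allFin; cartesianProductWith)
open import Data.List.Properties
  using (length-tabulate; length-map; length-++-≤ʳ; length-++; filter-accept; filter-reject; concatMap-map;
         concatMap-cong; map-concatMap; ++-assoc; ++-identityʳ; map-++; map-tabulate; map-injective; ∷-injective)
open import Data.List.Relation.Unary.All as All using (All; []; _∷_; universal)
open import Data.List.Relation.Unary.All.Properties using (++⁻ˡ; ++⁻ʳ; ++⁺; map⁺; concat⁺)
open import Data.Nat using (ℕ; zero; suc; _+_; _*_; _∸_; _%_; _≤_; _<_; z≤n; s≤s; s≤s⁻¹; parity)
open import Data.Nat.Combinatorics using (_C_; nCk+nC[k+1]≡[n+1]C[k+1]; nC1≡n; nCk≡nC[n∸k])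
open import Data.Nat.DivMod using (_/_; m*n/n≡m)
open import Data.Nat.ListAction using (sum)
open import Data.Nat.Properties
  using (≤-reflexive; m<m+n; ≤-<-trans; +-suc; m≤m+n; m≤n⇒m≤1+n; m+n∸n≡m; +-identityʳ; *-identityʳ; *-zeroʳ;
         *-comm; *-cancelˡ-≡; +-cancelʳ-≡; *-distribˡ-+; *-distribʳ-+; *-distribˡ-∸)
open import Data.Nat.Solver using (module +-*-Solver)
open +-*-Solver using (solve; _:+_; _:*_; _:=_; con)
open import Data.Parity.Base as ℙ using (Parity; 0ℙ; 1ℙ)
import Data.Parity.Properties as ℙₚ
open ℙₚ using (+-homo-+; *-homo-*)
open import Data.Product using (Σ-syntax; ∃-syntax; _×_; _,_; proj₁; proj₂)
open import Data.Vec using (Vec; _∷_)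
open import Function using (_∘_; id; case_of_)
open import Relation.Binary.PropositionalEquality

trueCount : ∀ {A : Set} → (A → Bool) → List A → ℕ
trueCount f xs = length (filter (λ x → f x ≟ true) xs)

fromBool : Bool → Parity
fromBool true  = 1ℙ
fromBool false = 0ℙ

fromBool-xor : ∀ a b → fromBool (a xor b) ≡ fromBool a ℙ.+ fromBool b
fromBool-xor true  true  = refl
fromBool-xor true  false = refl
fromBool-xor false b     = refl

parity-trueCount-∷ : ∀ {A : Set} (f : A → Bool) x xs →
  parity (trueCount f (x ∷ xs)) ≡ fromBool (f x) ℙ.+ parity (trueCount f xs)
parity-trueCount-∷ f x xs = byValue (f x) refl
  where
  byValue : ∀ b → f x ≡ b → parity (trueCount f (x ∷ xs)) ≡ fromBool b ℙ.+ parity (trueCount f xs)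
  byValue true  fx = trans (cong (parity ∘ length) (filter-accept (λ y → f y ≟ true) fx)) (+-homo-+ 1 (trueCount f xs))
  byValue false fx = cong (parity ∘ length) (filter-reject (λ y → f y ≟ true) (λ fx≡true → case trans (sym fx) fx≡true of λ ()))

parity-trueCount-cong : ∀ {A : Set} {f g : A → Bool} → (∀ x → f x ≡ g x) →
  ∀ xs → parity (trueCount f xs) ≡ parity (trueCount g xs)
parity-trueCount-cong f≗g []       = refl
parity-trueCount-cong {f = f} {g} f≗g (x ∷ xs) = begin
  parity (trueCount f (x ∷ xs))              ≡⟨ parity-trueCount-∷ f x xs ⟩
  fromBool (f x) ℙ.+ parity (trueCount f xs)  ≡⟨ cong₂ (λ b p → fromBool b ℙ.+ p) (f≗g x) (parity-trueCount-cong f≗g xs) ⟩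
  fromBool (g x) ℙ.+ parity (trueCount g xs)  ≡⟨ parity-trueCount-∷ g x xs ⟨
  parity (trueCount g (x ∷ xs))              ∎
  where open ≡-Reasoning

parity-trueCount-split : ∀ {M} (f : Vec Bool (suc M) → Bool) (vs : List (Vec Bool M)) →
  parity (trueCount f (concatMap (λ v → (true ∷ v) ∷ (false ∷ v) ∷ []) vs))
    ≡ parity (trueCount (λ v → f (true ∷ v) xor f (false ∷ v)) vs)
parity-trueCount-split f []       = refl
parity-trueCount-split f (v ∷ vs) = begin
  parity (trueCount f (t ∷ u ∷ rest))
    ≡⟨ parity-trueCount-∷ f t (u ∷ rest) ⟩
  fromBool (f t) ℙ.+ parity (trueCount f (u ∷ rest))
    ≡⟨ cong (fromBool (f t) ℙ.+_) (parity-trueCount-∷ f u rest) ⟩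
  fromBool (f t) ℙ.+ (fromBool (f u) ℙ.+ parity (trueCount f rest))
    ≡⟨ ℙₚ.+-assoc (fromBool (f t)) _ _ ⟨
  fromBool (f t) ℙ.+ fromBool (f u) ℙ.+ parity (trueCount f rest)
    ≡⟨ cong₂ ℙ._+_ (sym (fromBool-xor (f t) (f u))) (parity-trueCount-split f vs) ⟩
  fromBool (f t xor f u) ℙ.+ parity (trueCount (λ w → f (true ∷ w) xor f (false ∷ w)) vs)
    ≡⟨ parity-trueCount-∷ (λ w → f (true ∷ w) xor f (false ∷ w)) v vs ⟨
  parity (trueCount (λ w → f (true ∷ w) xor f (false ∷ w)) (v ∷ vs)) ∎
  where
  open ≡-Reasoning
  t = true ∷ v
  u = false ∷ v
  rest = concatMap (λ w → (true ∷ w) ∷ (false ∷ w) ∷ []) vs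

leaves : ∀ {n} → Formula n → List (Fin n)
leaves (var i) = i ∷ []
leaves (φ ⇀ ψ) = leaves φ ++ leaves ψ

leftmost : ∀ {n} → Formula n → Fin n
leftmost (var i) = i
leftmost (φ ⇀ _) = leftmost φ

spineArgs : ∀ {n} → Formula n → List (Formula n) → List (Formula n)
spineArgs (var _) acc = acc
spineArgs (φ ⇀ ψ) acc = spineArgs φ (ψ ∷ acc)

leaves-spineArgs : ∀ {n} (φ : Formula n) acc →
  leaves φ ++ concatMap leaves acc ≡ leftmost φ ∷ concatMap leaves (spineArgs φ acc)
leaves-spineArgs (var i) acc = refl
leaves-spineArgs (φ ⇀ ψ) acc = trans (++-assoc (leaves φ) (leaves ψ) _) (leaves-spineArgs φ (ψ ∷ acc))

All-spineArgs⁻ : ∀ {n} {P : Formula n → Set} (φ : Formula n) acc → All P (spineArgs φ acc) → All P acc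
All-spineArgs⁻ (var _) acc Ps = Ps
All-spineArgs⁻ (φ ⇀ ψ) acc Ps with All-spineArgs⁻ φ (ψ ∷ acc) Ps
... | _ ∷ Pacc = Pacc

rename : ∀ {m n} → (Fin m → Fin n) → Formula m → Formula n
rename f (var i) = var (f i)
rename f (φ ⇀ ψ) = rename f φ ⇀ rename f ψ

leaves-rename : ∀ {m n} (f : Fin m → Fin n) φ → leaves (rename f φ) ≡ map f (leaves φ)
leaves-rename f (var i) = refl
leaves-rename f (φ ⇀ ψ) = trans (cong₂ _++_ (leaves-rename f φ) (leaves-rename f ψ)) (sym (map-++ f (leaves φ) (leaves ψ)))

concatMap-leaves-rename : ∀ {m n} (f : Fin m → Fin n) F →
  concatMap leaves (map (rename f) F) ≡ map f (concatMap leaves F)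
concatMap-leaves-rename f F = begin
  concatMap leaves (map (rename f) F)      ≡⟨ concatMap-map leaves (rename f) F ⟩
  concatMap (leaves ∘ rename f) F          ≡⟨ concatMap-cong (leaves-rename f) F ⟩
  concatMap (map f ∘ leaves) F             ≡⟨ map-concatMap f leaves F ⟨
  map f (concatMap leaves F)               ∎
  where open ≡-Reasoning

eval-rename-suc : ∀ {n} b (v : Vec Bool n) φ → eval (b ∷ v) (rename suc φ) ≡ eval v φ
eval-rename-suc b v (var i) = refl
eval-rename-suc b v (φ ⇀ ψ) = cong₂ mimp (eval-rename-suc b v φ) (eval-rename-suc b v ψ)

IsSuc : ∀ {M} → Fin (suc M) → Set
IsSuc {M} i = ∃[ j ] i ≡ suc j

lower : ∀ {M} (ψ : Formula (suc M)) → All IsSuc (leaves ψ) → Formula M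
lower (var i) ((j , _) ∷ []) = var j
lower (φ ⇀ ψ) ps = lower φ (++⁻ˡ (leaves φ) ps) ⇀ lower ψ (++⁻ʳ (leaves φ) ps)

rename-suc-lower : ∀ {M} (ψ : Formula (suc M)) ps → rename suc (lower ψ ps) ≡ ψ
rename-suc-lower (var i) ((j , i≡suc-j) ∷ []) = cong var (sym i≡suc-j)
rename-suc-lower (φ ⇀ ψ) ps = cong₂ _⇀_ (rename-suc-lower φ _) (rename-suc-lower ψ _)

strengthen : ∀ {M} (G : List (Formula (suc M))) → All IsSuc (concatMap leaves G) →
  Σ[ H ∈ List (Formula M) ] map (rename suc) H ≡ G
strengthen []      _  = [] , refl
strengthen (ψ ∷ G) ps with strengthen G (++⁻ʳ (leaves ψ) ps)
... | H , H↑≡G = lower ψ (++⁻ˡ (leaves ψ) ps) ∷ H , cong₂ _∷_ (rename-suc-lower ψ _) H↑≡G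

HeadFree : ∀ {M} → Formula (suc M) → Set
HeadFree {M} ψ = ∀ (v : Vec Bool M) → eval (true ∷ v) ψ ≡ eval (false ∷ v) ψ

rename-suc-headFree : ∀ {M} (ψ : Formula M) → HeadFree (rename suc ψ)
rename-suc-headFree ψ v = trans (eval-rename-suc true v ψ) (sym (eval-rename-suc false v ψ))

all-headFree : ∀ {M} (F : List (Formula (suc M))) → All HeadFree F →
  ∀ v → all (eval (true ∷ v)) F ≡ all (eval (false ∷ v)) F
all-headFree []      []         v = refl
all-headFree (ψ ∷ F) (hψ ∷ hF) v = cong₂ _∧_ (hψ v) (all-headFree F hF v)

mimp-∧ : ∀ a b r → mimp a b ∧ r ≡ r xor (a ∧ (b ∧ r))
mimp-∧ true  true  r = sym (xor-same r)
mimp-∧ true  false r = sym (xor-identityʳ r)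
mimp-∧ false b     r = sym (xor-identityʳ r)

xor-cancelˡ : ∀ r x y → (r xor x) xor (r xor y) ≡ x xor y
xor-cancelˡ true  x y = xor-annihilates-not x y
xor-cancelˡ false x y = refl

-- Summing over the value of the leftmost variable p: since mimp a b ∧ r = r xor (a ∧ b ∧ r),
-- the head-free part r cancels and p ⇀ ψ behaves like the conjunction p ∧ ψ.
xor-leftmost : ∀ {M} (φ : Formula (suc M)) acc → leftmost φ ≡ zero → All HeadFree (spineArgs φ acc) →
  ∀ v → all (eval (true ∷ v)) (φ ∷ acc) xor all (eval (false ∷ v)) (φ ∷ acc)
          ≡ all (eval (true ∷ v)) (spineArgs φ acc)
xor-leftmost (var zero) acc _ _ v = xor-identityʳ _
xor-leftmost (φ ⇀ ψ) acc φ₀ hs v with All-spineArgs⁻ φ (ψ ∷ acc) hs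
... | hψ ∷ hacc = begin
  (mimp (⟦ t ⟧ φ) (⟦ t ⟧ ψ) ∧ R t) xor (mimp (⟦ f ⟧ φ) (⟦ f ⟧ ψ) ∧ R f)
    ≡⟨ cong₂ (λ b r → (mimp (⟦ t ⟧ φ) (⟦ t ⟧ ψ) ∧ R t) xor (mimp (⟦ f ⟧ φ) b ∧ r)) (sym (hψ v)) (sym (all-headFree acc hacc v)) ⟩
  (mimp (⟦ t ⟧ φ) (⟦ t ⟧ ψ) ∧ R t) xor (mimp (⟦ f ⟧ φ) (⟦ t ⟧ ψ) ∧ R t)
    ≡⟨ cong₂ _xor_ (mimp-∧ (⟦ t ⟧ φ) _ _) (mimp-∧ (⟦ f ⟧ φ) _ _) ⟩
  (R t xor (⟦ t ⟧ φ ∧ (⟦ t ⟧ ψ ∧ R t))) xor (R t xor (⟦ f ⟧ φ ∧ (⟦ t ⟧ ψ ∧ R t)))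
    ≡⟨ xor-cancelˡ (R t) _ _ ⟩
  (⟦ t ⟧ φ ∧ (⟦ t ⟧ ψ ∧ R t)) xor (⟦ f ⟧ φ ∧ (⟦ t ⟧ ψ ∧ R t))
    ≡⟨ cong (λ r → (⟦ t ⟧ φ ∧ (⟦ t ⟧ ψ ∧ R t)) xor (⟦ f ⟧ φ ∧ r)) (cong₂ _∧_ (hψ v) (all-headFree acc hacc v)) ⟩
  (⟦ t ⟧ φ ∧ (⟦ t ⟧ ψ ∧ R t)) xor (⟦ f ⟧ φ ∧ (⟦ f ⟧ ψ ∧ R f))
    ≡⟨ xor-leftmost φ (ψ ∷ acc) φ₀ hs v ⟩
  all (eval t) (spineArgs φ (ψ ∷ acc)) ∎
  where
  open ≡-Reasoning
  t = true ∷ v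
  f = false ∷ v
  ⟦_⟧ = eval
  R : Vec Bool _ → Bool
  R ν = all (eval ν) acc

all-rename-suc : ∀ {M} b (v : Vec Bool M) F → all (eval (b ∷ v)) (map (rename suc) F) ≡ all (eval v) F
all-rename-suc b v []      = refl
all-rename-suc b v (ψ ∷ F) = cong₂ _∧_ (eval-rename-suc b v ψ) (all-rename-suc b v F)

allFin-suc : ∀ M → allFin (suc M) ≡ zero ∷ map suc (allFin M)
allFin-suc M = cong (zero ∷_) (sym (map-tabulate id suc))

parity-trueCount-all : ∀ N (F : List (Formula N)) → concatMap leaves F ≡ allFin N →
  parity (trueCount (λ ν → all (eval ν) F) (valuations N)) ≡ 1ℙ
parity-trueCount-all zero    []      _ = refl
parity-trueCount-all zero    (φ ∷ F) e = case trans (sym (leaves-spineArgs φ F)) e of λ ()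
parity-trueCount-all (suc M) []      ()
parity-trueCount-all (suc M) (φ ∷ G) e = begin
  parity (trueCount (λ ν → all (eval ν) (φ ∷ G)) (valuations (suc M)))
    ≡⟨ parity-trueCount-split (λ ν → all (eval ν) (φ ∷ G)) (valuations M) ⟩
  parity (trueCount (λ v → all (eval (true ∷ v)) (φ ∷ G) xor all (eval (false ∷ v)) (φ ∷ G)) (valuations M))
    ≡⟨ parity-trueCount-cong xor-head (valuations M) ⟩
  parity (trueCount (λ v → all (eval v) H) (valuations M))
    ≡⟨ parity-trueCount-all M H leaves-H ⟩
  1ℙ ∎
  where
  open ≡-Reasoning
  head∷tail : leftmost φ ≡ zero × concatMap leaves (spineArgs φ G) ≡ map suc (allFin M)
  head∷tail = ∷-injective (trans (sym (leaves-spineArgs φ G)) (trans e (allFin-suc M)))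
  lowered : Σ[ H ∈ List (Formula M) ] map (rename suc) H ≡ spineArgs φ G
  lowered = strengthen (spineArgs φ G)
    (subst (All IsSuc) (sym (proj₂ head∷tail)) (map⁺ (universal (λ j → j , refl) (allFin M))))
  H = proj₁ lowered
  H↑ = proj₂ lowered
  leaves-H : concatMap leaves H ≡ allFin M
  leaves-H = map-injective Fin.suc-injective
    (trans (sym (concatMap-leaves-rename suc H)) (trans (cong (concatMap leaves) H↑) (proj₂ head∷tail)))
  xor-head : ∀ v → all (eval (true ∷ v)) (φ ∷ G) xor all (eval (false ∷ v)) (φ ∷ G) ≡ all (eval v) H
  xor-head v = begin
    all (eval (true ∷ v)) (φ ∷ G) xor all (eval (false ∷ v)) (φ ∷ G)
      ≡⟨ xor-leftmost φ G (proj₁ head∷tail) (subst (All HeadFree) H↑ (map⁺ (universal rename-suc-headFree H))) v ⟩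
    all (eval (true ∷ v)) (spineArgs φ G)      ≡⟨ cong (all (eval (true ∷ v))) H↑ ⟨
    all (eval (true ∷ v)) (map (rename suc) H) ≡⟨ all-rename-suc true v H ⟩
    all (eval v) H                             ∎

parity-countTrue : ∀ {n} (φ : Formula n) → leaves φ ≡ allFin n → parity (countTrue φ) ≡ 1ℙ
parity-countTrue {n} φ e = trans
  (parity-trueCount-cong (λ ν → sym (∧-identityʳ (eval ν φ))) (valuations n))
  (parity-trueCount-all n (φ ∷ []) (trans (++-identityʳ (leaves φ)) e))

antidiagonalSum : (ℕ → ℕ → Parity) → ℕ → Parity
antidiagonalSum G zero    = G 0 0
antidiagonalSum G (suc k) = G 0 (suc k) ℙ.+ antidiagonalSum (λ a b → G (suc a) b) k

splits-++ : ∀ {A : Set} (x : A) xs → All (λ (l , r) → l ++ r ≡ x ∷ xs) (splits x xs)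
splits-++ x []       = []
splits-++ x (y ∷ ys) = refl ∷ map⁺ (All.map (cong (x ∷_)) (splits-++ y ys))

parity-length-concatMap-splits : ∀ {A B : Set} (g : List A × List A → List B) (G : ℕ → ℕ → Parity) x y ys →
  (∀ l w ws → l ++ w ∷ ws ≡ y ∷ ys → parity (length (g (x ∷ l , w ∷ ws))) ≡ G (length l) (length ws)) →
  parity (length (concatMap g (splits x (y ∷ ys)))) ≡ antidiagonalSum G (length ys)
parity-length-concatMap-splits g G x y []       hyp =
  trans (cong (parity ∘ length) (++-identityʳ (g (x ∷ [] , y ∷ [])))) (hyp [] y [] refl)
parity-length-concatMap-splits g G x y (z ∷ zs) hyp = begin
  parity (length (g first ++ concatMap g rest))
    ≡⟨ cong parity (length-++ (g first)) ⟩
  parity (length (g first) + length (concatMap g rest))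
    ≡⟨ +-homo-+ (length (g first)) _ ⟩
  parity (length (g first)) ℙ.+ parity (length (concatMap g rest))
    ≡⟨ cong₂ ℙ._+_ (hyp [] y (z ∷ zs) refl) (cong (parity ∘ length) (concatMap-map g _ (splits y (z ∷ zs)))) ⟩
  G 0 (suc (length zs)) ℙ.+ parity (length (concatMap (λ (l , r) → g (x ∷ l , r)) (splits y (z ∷ zs))))
    ≡⟨ cong (G 0 (suc (length zs)) ℙ.+_)
         (parity-length-concatMap-splits (λ (l , r) → g (x ∷ l , r)) (λ a b → G (suc a) b) y z zs (λ l w ws e → hyp (y ∷ l) w ws (cong (y ∷_) e))) ⟩
  antidiagonalSum G (suc (length zs)) ∎
  where
  open ≡-Reasoning
  first = x ∷ [] , y ∷ z ∷ zs
  rest = map (λ (l , r) → (x ∷ l , r)) (splits y (z ∷ zs))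

cartesianProductWith⁺ : ∀ {A B C : Set} {P : A → Set} {Q : B → Set} {R : C → Set} (f : A → B → C) →
  (∀ {a b} → P a → Q b → R (f a b)) → ∀ {xs ys} → All P xs → All Q ys → All R (cartesianProductWith f xs ys)
cartesianProductWith⁺ f h []       qs = []
cartesianProductWith⁺ f h (p ∷ ps) qs = ++⁺ (map⁺ (All.map (h p) qs)) (cartesianProductWith⁺ f h ps qs)

length-cartesianProductWith : ∀ {A B C : Set} (f : A → B → C) xs ys →
  length (cartesianProductWith f xs ys) ≡ length xs * length ys
length-cartesianProductWith f []       ys = refl
length-cartesianProductWith f (x ∷ xs) ys =
  trans (length-++ (map (f x) ys)) (cong₂ _+_ (length-map (f x) ys) (length-cartesianProductWith f xs ys))

length-split : ∀ {A : Set} (l : List A) w ws {y : A} {ys} → l ++ w ∷ ws ≡ y ∷ ys →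
  length l ≤ length ys × length ws ≤ length ys
length-split l w ws {ys = ys} e = s≤s⁻¹ (subst (length l <_) |l++w∷ws| (m<m+n (length l) (s≤s z≤n)))
                      , s≤s⁻¹ (subst (length (w ∷ ws) ≤_) (cong length e) (length-++-≤ʳ (w ∷ ws) {l}))
  where
  |l++w∷ws| : length l + length (w ∷ ws) ≡ suc (length ys)
  |l++w∷ws| = trans (sym (length-++ l)) (cong length e)

bracketingsOf : ∀ {n} → ℕ → List (Fin n) → List (Formula n)
bracketingsOf fuel []       = []
bracketingsOf fuel (x ∷ xs) = bracketingsF fuel x xs

joins : ∀ {n} → ℕ → List (Fin n) × List (Fin n) → List (Formula n)
joins fuel (l , r) = cartesianProductWith _⇀_ (bracketingsOf fuel l) (bracketingsOf fuel r)

bracketingsF-suc : ∀ {n} fuel (x y : Fin n) ys →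
  bracketingsF (suc fuel) x (y ∷ ys) ≡ concatMap (joins fuel) (splits x (y ∷ ys))
bracketingsF-suc fuel x y ys =
  concatMap-cong (λ { ([] , _) → refl ; (_ ∷ _ , []) → refl ; (_ ∷ _ , _ ∷ _) → refl }) (splits x (y ∷ ys))

leaves-bracketingsOf : ∀ {n} fuel (xs : List (Fin n)) → All (λ φ → leaves φ ≡ xs) (bracketingsOf fuel xs)
leaves-bracketingsOf fuel       []           = []
leaves-bracketingsOf fuel       (x ∷ [])     = refl ∷ []
leaves-bracketingsOf zero       (x ∷ y ∷ ys) = []
leaves-bracketingsOf (suc fuel) (x ∷ y ∷ ys) rewrite bracketingsF-suc fuel x y ys =
  concat⁺ (map⁺ (All.map (λ {lr} → leaves-joins lr) (splits-++ x (y ∷ ys))))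
  where
  leaves-joins : ∀ lr → proj₁ lr ++ proj₂ lr ≡ x ∷ y ∷ ys → All (λ φ → leaves φ ≡ x ∷ y ∷ ys) (joins fuel lr)
  leaves-joins (l , r) e = cartesianProductWith⁺ _⇀_ (λ eφ eψ → trans (cong₂ _++_ eφ eψ) e)
    (leaves-bracketingsOf fuel l) (leaves-bracketingsOf fuel r)

module _ (P : ℕ → Parity) (P-zero : P 0 ≡ 1ℙ) (P-suc : ∀ k → P (suc k) ≡ antidiagonalSum (λ a b → P a ℙ.* P b) k) where

  parity-length-bracketingsF : ∀ {n} fuel (x : Fin n) xs → length xs < fuel →
    parity (length (bracketingsF fuel x xs)) ≡ P (length xs)
  parity-length-bracketingsF (suc fuel) x []       _               = sym P-zero
  parity-length-bracketingsF (suc fuel) x (y ∷ ys) (s≤s |ys|<fuel) = begin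
    parity (length (bracketingsF (suc fuel) x (y ∷ ys)))
      ≡⟨ cong (parity ∘ length) (bracketingsF-suc fuel x y ys) ⟩
    parity (length (concatMap (joins fuel) (splits x (y ∷ ys))))
      ≡⟨ parity-length-concatMap-splits (joins fuel) _ x y ys parity-joins ⟩
    antidiagonalSum (λ a b → P a ℙ.* P b) (length ys)
      ≡⟨ P-suc (length ys) ⟨
    P (length (y ∷ ys)) ∎
    where
    open ≡-Reasoning
    parity-joins : ∀ l w ws → l ++ w ∷ ws ≡ y ∷ ys →
      parity (length (joins fuel (x ∷ l , w ∷ ws))) ≡ P (length l) ℙ.* P (length ws)
    parity-joins l w ws e = begin
      parity (length (joins fuel (x ∷ l , w ∷ ws)))
        ≡⟨ cong parity (length-cartesianProductWith _⇀_ (bracketingsF fuel x l) (bracketingsF fuel w ws)) ⟩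
      parity (length (bracketingsF fuel x l) * length (bracketingsF fuel w ws))
        ≡⟨ *-homo-* (length (bracketingsF fuel x l)) _ ⟩
      parity (length (bracketingsF fuel x l)) ℙ.* parity (length (bracketingsF fuel w ws))
        ≡⟨ cong₂ ℙ._*_ (parity-length-bracketingsF fuel x l (≤-<-trans (proj₁ bounds) |ys|<fuel))
                       (parity-length-bracketingsF fuel w ws (≤-<-trans (proj₂ bounds) |ys|<fuel)) ⟩
      P (length l) ℙ.* P (length ws) ∎
      where bounds = length-split l w ws e

parity-sum-odd : ∀ {A : Set} (f : A → ℕ) xs → All (λ x → parity (f x) ≡ 1ℙ) xs →
  parity (sum (map f xs)) ≡ parity (length xs)
parity-sum-odd f []       []       = refl
parity-sum-odd f (x ∷ xs) (o ∷ os) = begin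
  parity (f x + sum (map f xs))         ≡⟨ +-homo-+ (f x) _ ⟩
  parity (f x) ℙ.+ parity (sum (map f xs)) ≡⟨ cong₂ ℙ._+_ o (parity-sum-odd f xs os) ⟩
  1ℙ ℙ.+ parity (length xs)             ≡⟨ +-homo-+ 1 (length xs) ⟨
  parity (length (x ∷ xs))              ∎
  where open ≡-Reasoning

parity-d : ∀ n → parity (d (suc n)) ≡ parity (length (bracketings n))
parity-d n = parity-sum-odd countTrue (bracketings n)
  (All.map (λ {φ} e → parity-countTrue φ (trans e (sym (allFin-suc n))))
           (leaves-bracketingsOf (suc n) (zero ∷ map suc (allFin n))))

double : ℕ → ℕ
double zero    = zero
double (suc n) = suc (suc (double n))

double≡n+n : ∀ n → double n ≡ n + n
double≡n+n zero    = refl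
double≡n+n (suc n) = cong suc (trans (cong suc (double≡n+n n)) (sym (+-suc n n)))

parity-double : ∀ n → parity (double n) ≡ 0ℙ
parity-double zero    = refl
parity-double (suc n) = parity-double n

data EvenOdd : ℕ → Set where
  even : ∀ j → EvenOdd (double j)
  odd  : ∀ j → EvenOdd (suc (double j))

evenOdd : ∀ n → EvenOdd n
evenOdd zero = even zero
evenOdd (suc n) with evenOdd n
... | even j = odd j
... | odd j  = even (suc j)

p+[x+p]≡x : ∀ p x → p ℙ.+ (x ℙ.+ p) ≡ x
p+[x+p]≡x 0ℙ x  = ℙₚ.+-identityʳ x
p+[x+p]≡x 1ℙ 0ℙ = refl
p+[x+p]≡x 1ℙ 1ℙ = refl

antidiagonalSum-sucʳ : ∀ G k → antidiagonalSum G (suc k) ≡ antidiagonalSum (λ a b → G a (suc b)) k ℙ.+ G (suc k) 0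
antidiagonalSum-sucʳ G zero    = refl
antidiagonalSum-sucʳ G (suc k) = trans
  (cong (G 0 (suc (suc k)) ℙ.+_) (antidiagonalSum-sucʳ (λ a b → G (suc a) b) k))
  (sym (ℙₚ.+-assoc (G 0 (suc (suc k))) _ _))

antidiagonalSum-symmetric : ∀ G → (∀ a b → G a b ≡ G b a) →
  ∀ k → antidiagonalSum G (suc (suc k)) ≡ antidiagonalSum (λ a b → G (suc a) (suc b)) k
antidiagonalSum-symmetric G G-sym k = begin
  G 0 (2 + k) ℙ.+ antidiagonalSum (λ a b → G (suc a) b) (suc k)
    ≡⟨ cong₂ ℙ._+_ (G-sym 0 (2 + k)) (antidiagonalSum-sucʳ (λ a b → G (suc a) b) k) ⟩
  G (2 + k) 0 ℙ.+ (antidiagonalSum (λ a b → G (suc a) (suc b)) k ℙ.+ G (2 + k) 0)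
    ≡⟨ p+[x+p]≡x (G (2 + k) 0) _ ⟩
  antidiagonalSum (λ a b → G (suc a) (suc b)) k ∎
  where open ≡-Reasoning

antidiagonalSum-square-double : ∀ g j → antidiagonalSum (λ a b → g a ℙ.* g b) (double j) ≡ g j
antidiagonalSum-square-double g zero    = ℙₚ.*-idem (g 0)
antidiagonalSum-square-double g (suc j) = trans
  (antidiagonalSum-symmetric _ (λ a b → ℙₚ.*-comm (g a) (g b)) (double j))
  (antidiagonalSum-square-double (g ∘ suc) j)

antidiagonalSum-square-suc-double : ∀ g j → antidiagonalSum (λ a b → g a ℙ.* g b) (suc (double j)) ≡ 0ℙ
antidiagonalSum-square-suc-double g zero    =
  trans (cong (g 0 ℙ.* g 1 ℙ.+_) (ℙₚ.*-comm (g 1) (g 0))) (ℙₚ.p+p≡0ℙ (g 0 ℙ.* g 1))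
antidiagonalSum-square-suc-double g (suc j) = trans
  (antidiagonalSum-symmetric _ (λ a b → ℙₚ.*-comm (g a) (g b)) (suc (double j)))
  (antidiagonalSum-square-suc-double (g ∘ suc) j)

[a+b]+[b+c]≡a+c : ∀ a b c → (a ℙ.+ b) ℙ.+ (b ℙ.+ c) ≡ a ℙ.+ c
[a+b]+[b+c]≡a+c a b c = begin
  (a ℙ.+ b) ℙ.+ (b ℙ.+ c) ≡⟨ ℙₚ.+-assoc a b (b ℙ.+ c) ⟩
  a ℙ.+ (b ℙ.+ (b ℙ.+ c)) ≡⟨ cong (a ℙ.+_) (ℙₚ.+-assoc b b c) ⟨
  a ℙ.+ (b ℙ.+ b ℙ.+ c)   ≡⟨ cong (λ p → a ℙ.+ (p ℙ.+ c)) (ℙₚ.p+p≡0ℙ b) ⟩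
  a ℙ.+ c                 ∎
  where open ≡-Reasoning

parity-pascal₂ : ∀ n k → parity ((2 + n) C (2 + k)) ≡ parity (n C k) ℙ.+ parity (n C (2 + k))
parity-pascal₂ n k = begin
  parity ((2 + n) C (2 + k))
    ≡⟨ cong parity (nCk+nC[k+1]≡[n+1]C[k+1] (suc n) (suc k)) ⟨
  parity (suc n C suc k + suc n C (2 + k))
    ≡⟨ cong₂ (λ x y → parity (x + y)) (nCk+nC[k+1]≡[n+1]C[k+1] n k) (nCk+nC[k+1]≡[n+1]C[k+1] n (suc k)) ⟨
  parity ((n C k + n C suc k) + (n C suc k + n C (2 + k)))
    ≡⟨ +-homo-+ (n C k + n C suc k) _ ⟩
  parity (n C k + n C suc k) ℙ.+ parity (n C suc k + n C (2 + k))
    ≡⟨ cong₂ ℙ._+_ (+-homo-+ (n C k) _) (+-homo-+ (n C suc k) _) ⟩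
  (parity (n C k) ℙ.+ parity (n C suc k)) ℙ.+ (parity (n C suc k) ℙ.+ parity (n C (2 + k)))
    ≡⟨ [a+b]+[b+c]≡a+c (parity (n C k)) _ _ ⟩
  parity (n C k) ℙ.+ parity (n C (2 + k)) ∎
  where open ≡-Reasoning

parity-C-double : ∀ a b → parity (double a C double b) ≡ parity (a C b)
parity-C-double a       zero    = refl
parity-C-double zero    (suc b) = refl
parity-C-double (suc a) (suc b) = begin
  parity (double (suc a) C double (suc b))
    ≡⟨ parity-pascal₂ (double a) (double b) ⟩
  parity (double a C double b) ℙ.+ parity (double a C double (suc b))
    ≡⟨ cong₂ ℙ._+_ (parity-C-double a b) (parity-C-double a (suc b)) ⟩
  parity (a C b) ℙ.+ parity (a C suc b)
    ≡⟨ +-homo-+ (a C b) _ ⟨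
  parity (a C b + a C suc b)
    ≡⟨ cong parity (nCk+nC[k+1]≡[n+1]C[k+1] a b) ⟩
  parity (suc a C suc b) ∎
  where open ≡-Reasoning

parity-C-double-suc : ∀ a b → parity (double a C suc (double b)) ≡ 0ℙ
parity-C-double-suc zero    b       = refl
parity-C-double-suc (suc a) zero    = trans (cong parity (nC1≡n (double (suc a)))) (parity-double a)
parity-C-double-suc (suc a) (suc b) = begin
  parity (double (suc a) C suc (double (suc b)))
    ≡⟨ parity-pascal₂ (double a) (suc (double b)) ⟩
  parity (double a C suc (double b)) ℙ.+ parity (double a C suc (double (suc b)))
    ≡⟨ cong₂ ℙ._+_ (parity-C-double-suc a b) (parity-C-double-suc a (suc b)) ⟩
  0ℙ ∎
  where open ≡-Reasoning

-- C(2n+2, n+1) = C(2n+1, n) + C(2n+1, n+1), and the two summands agree by symmetry.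
parity-C-central : ∀ n → parity (double (suc n) C suc n) ≡ 0ℙ
parity-C-central n = begin
  parity (double (suc n) C suc n)
    ≡⟨ cong parity (nCk+nC[k+1]≡[n+1]C[k+1] (suc (double n)) n) ⟨
  parity (suc (double n) C n + suc (double n) C suc n)
    ≡⟨ cong (λ x → parity (x + suc (double n) C suc n)) symmetry ⟩
  parity (suc (double n) C suc n + suc (double n) C suc n)
    ≡⟨ +-homo-+ (suc (double n) C suc n) _ ⟩
  parity (suc (double n) C suc n) ℙ.+ parity (suc (double n) C suc n)
    ≡⟨ ℙₚ.p+p≡0ℙ (parity (suc (double n) C suc n)) ⟩
  0ℙ ∎
  where
  open ≡-Reasoning
  n≤2n+1 : n ≤ suc (double n)
  n≤2n+1 = subst (λ m → n ≤ suc m) (sym (double≡n+n n)) (m≤n⇒m≤1+n (m≤m+n n n))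
  2n+1∸n≡n+1 : suc (double n) ∸ n ≡ suc n
  2n+1∸n≡n+1 = trans (cong (λ m → suc m ∸ n) (double≡n+n n)) (m+n∸n≡m (suc n) n)
  symmetry : suc (double n) C n ≡ suc (double n) C suc n
  symmetry = trans (nCk≡nC[n∸k] n≤2n+1) (cong (suc (double n) C_) 2n+1∸n≡n+1)

C-absorption : ∀ n k → suc k * (n C suc k) + k * (n C k) ≡ n * (n C k)
C-absorption n       zero    = trans (+-identityʳ _) (trans (+-identityʳ _) (trans (nC1≡n n) (sym (*-identityʳ n))))
C-absorption zero    (suc k) = cong₂ _+_ (*-zeroʳ (2 + k)) (*-zeroʳ (suc k))
C-absorption (suc n) (suc k) = begin
  (2 + k) * (suc n C (2 + k)) + suc k * (suc n C suc k)
    ≡⟨ cong₂ (λ x y → (2 + k) * x + suc k * y) (sym (nCk+nC[k+1]≡[n+1]C[k+1] n (suc k))) (sym (nCk+nC[k+1]≡[n+1]C[k+1] n k)) ⟩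
  (2 + k) * (B₁ + B₂) + suc k * (B₀ + B₁)
    ≡⟨ solve 4 (λ K B₀ B₁ B₂ → (con 2 :+ K) :* (B₁ :+ B₂) :+ (con 1 :+ K) :* (B₀ :+ B₁)
                 := ((con 2 :+ K) :* B₂ :+ (con 1 :+ K) :* B₁) :+ ((con 1 :+ K) :* B₁ :+ K :* B₀) :+ (B₁ :+ B₀))
               refl k B₀ B₁ B₂ ⟩
  ((2 + k) * B₂ + suc k * B₁) + (suc k * B₁ + k * B₀) + (B₁ + B₀)
    ≡⟨ cong₂ (λ x y → x + y + (B₁ + B₀)) (C-absorption n (suc k)) (C-absorption n k) ⟩
  n * B₁ + n * B₀ + (B₁ + B₀)
    ≡⟨ solve 3 (λ N B₀ B₁ → N :* B₁ :+ N :* B₀ :+ (B₁ :+ B₀) := (con 1 :+ N) :* (B₀ :+ B₁)) refl n B₀ B₁ ⟩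
  suc n * (B₀ + B₁)
    ≡⟨ cong (suc n *_) (nCk+nC[k+1]≡[n+1]C[k+1] n k) ⟩
  suc n * (suc n C suc k) ∎
  where
  open ≡-Reasoning
  B₀ = n C k
  B₁ = n C suc k
  B₂ = n C (2 + k)

catalan : ℕ → ℕ
catalan k = Cat (suc k)

-- The ballot formula C(2m, m) = catalan m + C(2m, m + 1), which also shows that the division is exact.
catalan+C≡central : ∀ m → catalan m + double m C suc m ≡ double m C m
catalan+C≡central m = *-cancelˡ-≡ _ _ (suc m) (begin
  suc m * (catalan m + X)          ≡⟨ *-distribˡ-+ (suc m) (catalan m) X ⟩
  suc m * catalan m + suc m * X    ≡⟨ cong₂ _+_ (cong (suc m *_) catalan≡Y∸X) [m+1]X≡mY ⟩
  suc m * (Y ∸ X) + m * Y          ≡⟨ cong (_+ m * Y) [m+1][Y∸X]≡Y ⟩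
  suc m * Y                        ∎)
  where
  open ≡-Reasoning
  Y = double m C m
  X = double m C suc m
  [m+1]X≡mY : suc m * X ≡ m * Y
  [m+1]X≡mY = +-cancelʳ-≡ (m * Y) (suc m * X) (m * Y) (begin
    suc m * X + m * Y ≡⟨ C-absorption (double m) m ⟩
    double m * Y      ≡⟨ cong (_* Y) (double≡n+n m) ⟩
    (m + m) * Y       ≡⟨ *-distribʳ-+ Y m m ⟩
    m * Y + m * Y     ∎)
  [m+1][Y∸X]≡Y : suc m * (Y ∸ X) ≡ Y
  [m+1][Y∸X]≡Y = begin
    suc m * (Y ∸ X)         ≡⟨ *-distribˡ-∸ (suc m) Y X ⟩
    suc m * Y ∸ suc m * X   ≡⟨ cong (suc m * Y ∸_) [m+1]X≡mY ⟩
    Y + m * Y ∸ m * Y       ≡⟨ m+n∸n≡m Y (m * Y) ⟩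
    Y                       ∎
  catalan≡Y∸X : catalan m ≡ Y ∸ X
  catalan≡Y∸X = begin
    ((2 * m) C m) / suc m       ≡⟨ cong (λ t → (t C m) / suc m) (trans (cong (m +_) (+-identityʳ m)) (sym (double≡n+n m))) ⟩
    Y / suc m                   ≡⟨ cong (_/ suc m) (trans (sym [m+1][Y∸X]≡Y) (*-comm (suc m) (Y ∸ X))) ⟩
    (Y ∸ X) * suc m / suc m     ≡⟨ m*n/n≡m (Y ∸ X) (suc m) ⟩
    Y ∸ X                       ∎

parity-catalan : ∀ m → parity (catalan m) ≡ parity (double m C m) ℙ.+ parity (double m C suc m)
parity-catalan m = begin
  parity c                              ≡⟨ p+[x+p]≡x (parity X) (parity c) ⟨
  parity X ℙ.+ (parity c ℙ.+ parity X)  ≡⟨ cong (parity X ℙ.+_) (+-homo-+ c X) ⟨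
  parity X ℙ.+ parity (c + X)           ≡⟨ cong (λ t → parity X ℙ.+ parity t) (catalan+C≡central m) ⟩
  parity X ℙ.+ parity (double m C m)    ≡⟨ ℙₚ.+-comm (parity X) _ ⟩
  parity (double m C m) ℙ.+ parity X    ∎
  where
  open ≡-Reasoning
  c = catalan m
  X = double m C suc m

parity-catalan-suc-double : ∀ j → parity (catalan (suc (double j))) ≡ parity (catalan j)
parity-catalan-suc-double j = begin
  parity (catalan m)
    ≡⟨ parity-catalan m ⟩
  parity (double m C m) ℙ.+ parity (double m C double (suc j))
    ≡⟨ cong₂ ℙ._+_ (parity-C-double-suc m j) (parity-C-double m (suc j)) ⟩
  parity (suc (double j) C suc j)
    ≡⟨ cong parity (nCk+nC[k+1]≡[n+1]C[k+1] (double j) j) ⟨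
  parity (double j C j + double j C suc j)
    ≡⟨ +-homo-+ (double j C j) _ ⟩
  parity (double j C j) ℙ.+ parity (double j C suc j)
    ≡⟨ parity-catalan j ⟨
  parity (catalan j) ∎
  where
  open ≡-Reasoning
  m = suc (double j)

parity-catalan-double-suc : ∀ j → parity (catalan (double (suc j))) ≡ 0ℙ
parity-catalan-double-suc j = begin
  parity (catalan m)
    ≡⟨ parity-catalan m ⟩
  parity (double m C double (suc j)) ℙ.+ parity (double m C suc m)
    ≡⟨ cong₂ ℙ._+_ (trans (parity-C-double m (suc j)) (parity-C-central j)) (parity-C-double-suc m (suc j)) ⟩
  0ℙ ∎
  where
  open ≡-Reasoning
  m = double (suc j)

parity-catalan-suc : ∀ k → parity (catalan (suc k)) ≡ antidiagonalSum (λ a b → parity (catalan a) ℙ.* parity (catalan b)) k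
parity-catalan-suc k with evenOdd k
... | even j = trans (parity-catalan-suc-double j) (sym (antidiagonalSum-square-double (parity ∘ catalan) j))
... | odd j  = trans (parity-catalan-double-suc j) (sym (antidiagonalSum-square-suc-double (parity ∘ catalan) j))

parity⇒%2 : ∀ m n → parity m ≡ parity n → m % 2 ≡ n % 2
parity⇒%2 (suc (suc m)) n             e  = parity⇒%2 m n e
parity⇒%2 m             (suc (suc n)) e  = parity⇒%2 m n e
parity⇒%2 zero          zero          _  = refl
parity⇒%2 (suc zero)    (suc zero)    _  = refl
parity⇒%2 zero          (suc zero)    ()
parity⇒%2 (suc zero)    zero          ()

proposition4p3 : (n : ℕ) → d (suc n) % 2 ≡ Cat (suc n) % 2
proposition4p3 n = parity⇒%2 (d (suc n)) (Cat (suc n)) (begin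
  parity (d (suc n))
    ≡⟨ parity-d n ⟩
  parity (length (bracketingsF (suc n) zero vars))
    ≡⟨ parity-length-bracketingsF (parity ∘ catalan) refl parity-catalan-suc (suc n) zero vars (s≤s (≤-reflexive |vars|)) ⟩
  parity (catalan (length vars))
    ≡⟨ cong (parity ∘ catalan) |vars| ⟩
  parity (Cat (suc n)) ∎)
  where
  open ≡-Reasoning
  vars = map suc (allFin n)
  |vars| : length vars ≡ n
  |vars| = trans (length-map suc (allFin n)) (length-tabulate id)
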